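{- Let $n\in\{6,10,12\}$ and $V_0=\{v\in\{ -1,1\}^n : v_1=1,\ \sum_i v_i=0\}$. Then there exist signs $\varepsilon_v\in\{ -1,1\}$, one for each $v\in V_0$, such that $\sum_{v\in V_0}\varepsilon_v v=0$. -}

module Defs where

open import Data.Nat using (ℕ; zero; suc)
open import Data.Integer using (ℤ; +_; -[1+_]; _+_; _*_; 0ℤ; 1ℤ; -1ℤ)
open import Data.Vec using (Vec; []; _∷_; head; foldr; replicate; zipWith; map)
open import Data.List using (List; []; _∷_; _++_; filter; concatMap)
import Data.List as L
open import Relation.Nullary using (Dec; _×-dec_)
open import Relation.Binary.PropositionalEquality using (_≡_)
import Data.Integer.Properties as ℤP
open import Data.Empty using (⊥)

data Sign : Set where
  plus minus : Sign

⟦_⟧ : Sign → ℤ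
⟦ plus ⟧ = 1ℤ
⟦ minus ⟧ = -1ℤ

toℤ : ∀ {n} → Vec Sign n → Vec ℤ n
toℤ = map ⟦_⟧

allSignVecs : (n : ℕ) → List (Vec Sign n)
allSignVecs zero = [] ∷ []
allSignVecs (suc n) = L.map (plus ∷_) (allSignVecs n) ++ L.map (minus ∷_) (allSignVecs n)

coordSum : ∀ {n} → Vec Sign n → ℤ
coordSum v = foldr _ _+_ 0ℤ (toℤ v)

-- membership in V₀ : first coordinate is 1 and coordinate sum is 0
-- (for n = 0 there is no first coordinate; irrelevant for the theorem)
firstIsPlus : ∀ {n} → Vec Sign n → Set
firstIsPlus [] = ⊥
firstIsPlus (x ∷ _) = x ≡ plus

firstIsPlus? : ∀ {n} (v : Vec Sign n) → Dec (firstIsPlus v)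
firstIsPlus? [] = Relation.Nullary.no (λ ())
firstIsPlus? (plus ∷ _) = Relation.Nullary.yes _≡_.refl
firstIsPlus? (minus ∷ _) = Relation.Nullary.no (λ ())

open import Data.Product using (_×_)

InV₀ : ∀ {n} → Vec Sign n → Set
InV₀ v = firstIsPlus v × (coordSum v ≡ 0ℤ)

InV₀? : ∀ {n} (v : Vec Sign n) → Dec (InV₀ v)
InV₀? v = firstIsPlus? v ×-dec (coordSum v ℤP.≟ 0ℤ)

-- V₀ as an explicit duplicate-free list
V₀ : (n : ℕ) → List (Vec Sign n)
V₀ n = filter InV₀? (allSignVecs n)

zeroVec : ∀ {n} → Vec ℤ n
zeroVec = replicate _ 0ℤ

_⊕_ : ∀ {n} → Vec ℤ n → Vec ℤ n → Vec ℤ n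
_⊕_ = zipWith _+_

_·_ : ∀ {n} → ℤ → Vec ℤ n → Vec ℤ n
c · v = map (c *_) v

signedSum : ∀ {n} → (Vec Sign n → Sign) → List (Vec Sign n) → Vec ℤ n
signedSum ε [] = zeroVec
signedSum ε (v ∷ vs) = (⟦ ε v ⟧ · toℤ v) ⊕ signedSum ε vs

{-# OPTIONS --safe #-}
-- Write v ∈ V₀ as v = (1, w). If ε_v depends only on the cyclic class of w under rotation, then
-- Σ ε_v v = (Σ ε_v, c, …, c) for some c, and since every v has coordinate sum 0 we get
-- Σ ε_v + (n − 1) c = 0. So Σ ε_v v = 0 as soon as ε takes both values equally often.
-- The number of cyclic runs of +1 in w is such an invariant, and the classes with 1 or 3 runs
-- make up exactly half of V₀ for n = 6, 10, 12 (5 of 10, 63 of 126, 231 of 462).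
module Submission where

open import Defs
open import Data.Nat using (ℕ; zero; suc)
open import Data.Vec using (Vec; []; _∷_; last)
open import Data.Sum using (_⊎_; inj₁; inj₂)
open import Data.Product using (Σ; _,_)
open import Relation.Binary.PropositionalEquality using (_≡_; refl)

runStartsAfter : ∀ {m} → Sign → Vec Sign m → ℕ
runStartsAfter _     []         = zero
runStartsAfter minus (plus ∷ w) = suc (runStartsAfter plus w)
runStartsAfter _     (s ∷ w)    = runStartsAfter s w

cyclicRuns : ∀ {m} → Vec Sign (suc m) → ℕ
cyclicRuns w = runStartsAfter (last w) w

oneOrThree : ℕ → Sign
oneOrThree 1 = plus
oneOrThree 3 = plus
oneOrThree _ = minus

runSign : ∀ {m} → Vec Sign (suc (suc m)) → Sign
runSign (_ ∷ w) = oneOrThree (cyclicRuns w)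

lemma8 : (n : ℕ) → (n ≡ 6 ⊎ n ≡ 10 ⊎ n ≡ 12) →
    Σ (Vec Sign n → Sign) (λ ε → signedSum ε (V₀ n) ≡ zeroVec)
lemma8 .6  (inj₁ refl)        = runSign , refl
lemma8 .10 (inj₂ (inj₁ refl)) = runSign , refl
lemma8 .12 (inj₂ (inj₂ refl)) = runSign , refl
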